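{- Let $X$ be a finite set and $\mathcal{D}\subseteq\mathcal{R}(X)$. Suppose one of the following holds: (i) $\mathcal{D}$ is a median domain; (ii) $\mathcal{D}$ is connected; (iii) the graph $\Gamma_{\mathcal{D}}$ is acyclic (a tree). Then for all $R,R',Q\in\mathcal{D}$: $Q\in[R,R']$ if and only if $Q$ lies on some shortest path in $\Gamma_{\mathcal{D}}$ between $R$ and $R'$.
   Context: $\mathcal{R}(X)$ is the set of strict linear orders on $X$. For $R,R'\in\mathcal{R}(X)$ let $[R,R']=\{Q\in\mathcal{R}(X): Q\supseteq R\cap R'\}$ (orders agreeing with all pairwise comparisons on which $R,R'$ agree). $\mathcal{D}$ is a median domain if for all $R_1,R_2,R_3\in\mathcal{D}$ there is $R\in\mathcal{D}\cap[R_1,R_2]\cap[R_1,R_3]\cap[R_2,R_3]$. The associated graph $\Gamma_{\mathcal{D}}$ has vertex set $\mathcal{D}$, with distinct $R,R'\in\mathcal{D}$ adjacent iff $[R,R']\cap\mathcal{D}=\{R,R'\}$. $\mathcal{D}$ is called connected if $\Gamma_{\mathcal{D}}$ is a subgraph of the permutohedron, i.e., any two adjacent vertices of $\Gamma_{\mathcal{D}}$ differ only by swapping one pair of alternatives that are adjacent in both orders. -}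

module Defs where

open import Data.Nat using (ℕ; zero; suc; _≤_)
open import Data.Fin using (Fin; zero; suc; inject₁; fromℕ)
open import Data.Bool using (Bool; true; false)
open import Data.List using (List)
open import Data.List.Relation.Unary.Any using (Any)
open import Data.Product using (Σ; ∃; ∃-syntax; _×_; _,_)
open import Data.Sum using (_⊎_)
open import Relation.Binary.PropositionalEquality using (_≡_; _≢_)
open import Relation.Nullary using (¬_)

-- The finite set X is Fin n. A binary relation on X is a Bool-valued
-- function; R x y ≡ true means "x is ranked above y in R" (x R y).
Rel : ℕ → Set
Rel n = Fin n → Fin n → Bool

record IsStrictLinear {n : ℕ} (R : Rel n) : Set where
  field
    irrefl : ∀ x → R x x ≡ false
    trans  : ∀ x y z → R x y ≡ true → R y z ≡ true → R x z ≡ true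
    total  : ∀ x y → x ≢ y → (R x y ≡ true) ⊎ (R y x ≡ true)

_≐_ : ∀ {n} → Rel n → Rel n → Set
R ≐ Q = ∀ x y → R x y ≡ Q x y

-- A domain D ⊆ R(X) is given as a finite list of relations (each of which
-- is required to be a strict linear order); membership is up to ≐.
_∈D_ : ∀ {n} → Rel n → List (Rel n) → Set
R ∈D D = Any (λ S → R ≐ S) D

-- Q ∈ [R , R'] : Q is a strict linear order with Q ⊇ R ∩ R'.
Between : ∀ {n} → Rel n → Rel n → Rel n → Set
Between {n} R R' Q =
  IsStrictLinear Q ×
  (∀ (x y : Fin n) → R x y ≡ true → R' x y ≡ true → Q x y ≡ true)

Median : ∀ {n} → List (Rel n) → Set
Median D = ∀ R₁ R₂ R₃ → R₁ ∈D D → R₂ ∈D D → R₃ ∈D D →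
  ∃[ R ] (R ∈D D × Between R₁ R₂ R × Between R₁ R₃ R × Between R₂ R₃ R)

Adjacent : ∀ {n} → List (Rel n) → Rel n → Rel n → Set
Adjacent D R R' =
  R ∈D D × R' ∈D D × ¬ (R ≐ R') ×
  (∀ Q → Q ∈D D → Between R R' Q → (Q ≐ R) ⊎ (Q ≐ R'))

SwapAdjacent : ∀ {n} → Rel n → Rel n → Set
SwapAdjacent {n} R R' = Σ (Fin n) λ x → Σ (Fin n) λ y →
  R x y ≡ true × R' y x ≡ true ×
  (∀ u v → ¬ (u ≡ x × v ≡ y) → ¬ (u ≡ y × v ≡ x) → R u v ≡ R' u v) ×
  (∀ z → ¬ (R x z ≡ true × R z y ≡ true)) ×
  (∀ z → ¬ (R' y z ≡ true × R' z x ≡ true))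

-- D is connected: Γ_D is a subgraph of the permutohedron.
Connected : ∀ {n} → List (Rel n) → Set
Connected D = ∀ R R' → Adjacent D R R' → SwapAdjacent R R'

IsWalk : ∀ {n} → List (Rel n) → (k : ℕ) → (Fin (suc k) → Rel n) → Set
IsWalk D k p = ∀ (i : Fin k) → Adjacent D (p (inject₁ i)) (p (suc i))

Walk : ∀ {n} → List (Rel n) → Rel n → Rel n → ℕ → Set
Walk {n} D R R' k = Σ (Fin (suc k) → Rel n) λ p →
  IsWalk D k p × (p zero ≐ R) × (p (fromℕ k) ≐ R')

Cycle : ∀ {n} → List (Rel n) → Set
Cycle {n} D = Σ ℕ λ k → Σ (Fin (suc k) → Rel n) λ p →
  3 ≤ k × IsWalk D k p × (p zero ≐ p (fromℕ k)) ×
  (∀ (i j : Fin k) → p (inject₁ i) ≐ p (inject₁ j) → i ≡ j)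

Acyclic : ∀ {n} → List (Rel n) → Set
Acyclic D = ¬ Cycle D

OnShortestPath : ∀ {n} → List (Rel n) → Rel n → Rel n → Rel n → Set
OnShortestPath D R R' Q = Σ ℕ λ k → Σ (Walk D R R' k) λ w →
  (∀ k' → Walk D R R' k' → k ≤ k') ×
  ∃[ i ] (Q ≐ Data.Product.proj₁ w i)

module Submission where

-- The argument rests on two properties of Γ_D:
--   Dichotomy: for every edge R — S and R' ∈ D, S ∈ [R , R'] or R ∈ [S , R'];
--   Shortcut:  if S is a neighbour of R with S ∈ [R , R'], then any path
--              R → R' of length k gives a path S → R' of length < k.
-- Given both, every vertex of a shortest path R → R' lies in [R , R'], and
-- conversely Q ∈ [R , R'] lies on the path that goes monotonically from R to
-- Q and then follows a path to R' shortened once per step.  Monotone paths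
-- exist in every domain, by induction on the Kendall distance, which is
-- additive along intervals.

open import Defs
open import Data.Bool using (Bool; true; false)
open import Data.Bool.Properties using (¬-not) renaming (_≟_ to _≟ᵇ_)
open import Data.Empty using (⊥; ⊥-elim)
open import Data.Fin using (Fin; zero; suc; inject₁; fromℕ) renaming (_≟_ to _≟ᶠ_)
import Data.Fin.Properties as Fin
open import Data.List using (List)
open import Data.List.Relation.Unary.All using (All; lookupₛ; tabulateₛ; all?)
open import Data.List.Relation.Unary.Any using (Any; any?) renaming (map to any-map)
open import Data.List.Membership.Setoid using (find)
open import Data.List.Membership.Setoid.Properties using (∈-resp-≈)
open import Data.Nat using (ℕ; zero; suc; _+_; _≤_; _<_; z≤n; s≤s)
open import Data.Nat.Properties
  using (≤-refl; ≤-trans; ≤-reflexive; <-≤-trans; +-mono-≤; +-comm; m≤m+n; m≤n+m; m<m+n; m<n+m; module ≤-Reasoning; +-identityʳ; +-commutativeSemigroup; <-irrefl; ≤-pred; n≤1+n; +-suc; <-trans; m<n⇒m<1+n; ≮⇒≥; m≤n⇒m<n∨m≡n)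
open import Algebra.Properties.CommutativeSemigroup +-commutativeSemigroup using (interchange)
open import Data.Nat.Induction using (<-wellFounded)
open import Data.Product using (Σ; ∃-syntax; _×_; _,_; proj₁; proj₂)
open import Data.Sum using (_⊎_; inj₁; inj₂; [_,_]) renaming (map to ⊎-map; swap to ⊎-swap)
open import Data.Unit using (⊤; tt)
open import Function.Bundles using (_⇔_; mk⇔)
open import Induction.WellFounded using (Acc; acc)
open import Level using (0ℓ)
open import Relation.Binary.Bundles using (Setoid)
open import Relation.Binary.PropositionalEquality using (_≡_; _≢_; refl; sym; trans; cong; cong₂; subst; subst₂; module ≡-Reasoning)
open import Relation.Nullary using (¬_; Dec; yes; no)
open import Relation.Nullary.Decidable using (map′; _×-dec_; _⊎-dec_; _→-dec_; ¬?)

true≢false : true ≢ false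
true≢false ()

module _ {n : ℕ} where

  ≐-refl : {A : Rel n} → A ≐ A
  ≐-refl x y = refl

  ≐-sym : {A B : Rel n} → A ≐ B → B ≐ A
  ≐-sym e x y = sym (e x y)

  ≐-trans : {A B C : Rel n} → A ≐ B → B ≐ C → A ≐ C
  ≐-trans e f x y = trans (e x y) (f x y)

  ≐-setoid : Setoid 0ℓ 0ℓ
  ≐-setoid = record
    { Carrier = Rel n ; _≈_ = _≐_
    ; isEquivalence = record { refl = ≐-refl ; sym = ≐-sym ; trans = ≐-trans } }

  _≐?_ : (A B : Rel n) → Dec (A ≐ B)
  A ≐? B = Fin.all? λ x → Fin.all? λ y → A x y ≟ᵇ B x y

  linear-resp : {A B : Rel n} → A ≐ B → IsStrictLinear A → IsStrictLinear B
  linear-resp e lin = record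
    { irrefl = λ x → trans (sym (e x x)) (irrefl x)
    ; trans  = λ x y z p q → trans (sym (e x z)) (IsStrictLinear.trans lin x y z (trans (e x y) p) (trans (e y z) q))
    ; total  = λ x y x≢y → ⊎-map (trans (sym (e x y))) (trans (sym (e y x))) (total x y x≢y) }
    where open IsStrictLinear lin using (irrefl; total)

  module _ {A : Rel n} (lin : IsStrictLinear A) where
    open IsStrictLinear lin using (irrefl; total)

    above⇒≢ : ∀ {x y} → A x y ≡ true → x ≢ y
    above⇒≢ {x} Axy refl with trans (sym Axy) (irrefl x)
    ... | ()

    above-asym : ∀ {x y} → A x y ≡ true → A y x ≡ false
    above-asym {x} {y} Axy = ¬-not λ Ayx → above⇒≢ (IsStrictLinear.trans lin x y x Axy Ayx) refl

    not-above⇒below : ∀ {x y} → A x y ≡ false → x ≢ y → A y x ≡ true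
    not-above⇒below {x} {y} ¬Axy x≢y with total x y x≢y
    ... | inj₁ Axy with trans (sym ¬Axy) Axy
    ...   | ()
    not-above⇒below ¬Axy x≢y | inj₂ Ayx = Ayx

    above-both-ways : ∀ {x y} → A x y ≡ true → A y x ≡ true → ⊥
    above-both-ways Axy Ayx with trans (sym Ayx) (above-asym Axy)
    ... | ()

  Btw : Rel n → Rel n → Rel n → Set
  Btw R R' Q = ∀ x y → R x y ≡ true → R' x y ≡ true → Q x y ≡ true

  btw? : (R R' Q : Rel n) → Dec (Btw R R' Q)
  btw? R R' Q = Fin.all? λ x → Fin.all? λ y → imp? (R x y) (R' x y) (Q x y)
    where
    imp? : (a b c : Bool) → Dec (a ≡ true → b ≡ true → c ≡ true)
    imp? false b     c     = yes λ ()
    imp? true  false c     = yes λ _ ()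
    imp? true  true  true  = yes λ _ _ → refl
    imp? true  true  false = no λ f → case (f refl refl)
      where case : false ≡ true → ⊥
            case ()

  btw-resp : {R R' Q S S' P : Rel n} → R ≐ S → R' ≐ S' → Q ≐ P → Btw R R' Q → Btw S S' P
  btw-resp e e' f b x y Sxy S'xy = trans (sym (f x y)) (b x y (trans (e x y) Sxy) (trans (e' x y) S'xy))

  btw-left : {A B : Rel n} → Btw A B A
  btw-left x y Axy _ = Axy

  btw-right : {A B : Rel n} → Btw A B B
  btw-right x y _ Bxy = Bxy

  btw-sym : {A B C : Rel n} → Btw A B C → Btw B A C
  btw-sym b x y Bxy Axy = b x y Axy Bxy

  btw-nestʳ : {A B C V : Rel n} → Btw A B C → Btw C B V → Btw A B V
  btw-nestʳ b c x y Axy Bxy = c x y (b x y Axy Bxy) Bxy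

  btw-nestˡ : {A B C V : Rel n} → Btw A B C → Btw A C V → Btw A B V
  btw-nestˡ b c x y Axy Bxy = c x y Axy (b x y Axy Bxy)

  btw-convex : {A B S P M : Rel n} → Btw A B S → Btw A B P → Btw S P M → Btw A B M
  btw-convex s p m x y Axy Bxy = m x y (s x y Axy Bxy) (p x y Axy Bxy)

  -- Exchange: if Q ∈ [A , B] and Z ∈ [A , Q], then Q ∈ [Z , B]
  -- (on the route A → Z → Q → B, Q separates Z from B).
  btw-exchange : {A B Q Z : Rel n} → IsStrictLinear A → IsStrictLinear Q → IsStrictLinear Z →
    Btw A B Q → Btw A Q Z → Btw Z B Q
  btw-exchange {A} {_} {Q} {Z} linA linQ linZ q z x y Zxy Bxy with A x y in Axy
  ... | true = q x y Axy Bxy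
  ... | false with Q x y in Qxy
  ...   | true  = refl
  ...   | false = ⊥-elim (above-both-ways linZ Zxy Zyx)
    where
    x≢y : x ≢ y
    x≢y = above⇒≢ linZ Zxy
    Zyx : Z y x ≡ true
    Zyx = z y x (not-above⇒below linA Axy x≢y) (not-above⇒below linQ Qxy x≢y)

  btw-geodesic : {A B C D : Rel n} → IsStrictLinear B → IsStrictLinear C → IsStrictLinear D →
    Btw A D B → Btw B D C → Btw A C B
  btw-geodesic linB linC linD b c = btw-sym (btw-exchange linD linB linC (btw-sym b) (btw-sym c))

  btw-antisym : {R R' S : Rel n} → IsStrictLinear R → IsStrictLinear R' → IsStrictLinear S →
    Btw R R' S → Btw S R' R → R ≐ S
  btw-antisym {R' = R'} linR linR' linS s r x y = bool-ext (included linR linS s r) (included linS linR r s)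
    where
    bool-ext : {a b : Bool} → (a ≡ true → b ≡ true) → (b ≡ true → a ≡ true) → a ≡ b
    bool-ext {false} {false} f g = refl
    bool-ext {false} {true}  f g = g refl
    bool-ext {true}  {false} f g = sym (f refl)
    bool-ext {true}  {true}  f g = refl
    included : {A B : Rel n} → IsStrictLinear A → IsStrictLinear B → Btw A R' B → Btw B R' A →
      A x y ≡ true → B x y ≡ true
    included {A} {B} linA linB b a Axy with R' x y in R'xy
    ... | true = b x y Axy R'xy
    ... | false with B x y in Bxy
    ...   | true  = refl
    ...   | false = ⊥-elim (above-both-ways linA Axy
                      (a y x (not-above⇒below linB Bxy x≢y) (not-above⇒below linR' R'xy x≢y)))
      where x≢y : x ≢ y
            x≢y = above⇒≢ linA Axy

∑ : ∀ {m} → (Fin m → ℕ) → ℕ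
∑ {zero}  f = 0
∑ {suc m} f = f zero + ∑ (λ i → f (suc i))

∑-+ : ∀ {m} (f g h : Fin m → ℕ) → (∀ i → f i ≡ g i + h i) → ∑ f ≡ ∑ g + ∑ h
∑-+ {zero}  f g h e = refl
∑-+ {suc m} f g h e = begin
  f zero + ∑ (λ i → f (suc i))                       ≡⟨ cong₂ _+_ (e zero) (∑-+ _ _ _ (λ i → e (suc i))) ⟩
  (g zero + h zero) + (∑ (λ i → g (suc i)) + ∑ (λ i → h (suc i)))  ≡⟨ interchange (g zero) _ _ _ ⟩
  ∑ g + ∑ h                                          ∎
  where open ≡-Reasoning

∑-mono : ∀ {m} (f g : Fin m → ℕ) → (∀ i → f i ≤ g i) → ∑ f ≤ ∑ g
∑-mono {zero}  f g le = z≤n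
∑-mono {suc m} f g le = +-mono-≤ (le zero) (∑-mono _ _ (λ i → le (suc i)))

∑-term : ∀ {m} (f : Fin m → ℕ) i → f i ≤ ∑ f
∑-term f zero    = m≤m+n (f zero) _
∑-term f (suc i) = ≤-trans (∑-term (λ j → f (suc j)) i) (m≤n+m _ (f zero))

∑-zero : ∀ {m} (f : Fin m → ℕ) → (∀ i → f i ≡ 0) → ∑ f ≡ 0
∑-zero {zero}  f z = refl
∑-zero {suc m} f z = cong₂ _+_ (z zero) (∑-zero _ (λ i → z (suc i)))

∑-single : ∀ {m} (f : Fin m → ℕ) i₀ → (∀ i → i ≢ i₀ → f i ≡ 0) → ∑ f ≡ f i₀
∑-single f zero z = trans (cong (f zero +_) (∑-zero _ (λ i → z (suc i) λ ()))) (+-identityʳ (f zero))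
∑-single f (suc i₀) z =
  trans (cong (_+ ∑ (λ i → f (suc i))) (z zero λ ())) (∑-single (λ i → f (suc i)) i₀ (λ i i≢i₀ → z (suc i) (λ e → i≢i₀ (Fin.suc-injective e))))

∑∑ : ∀ {m} → (Fin m → Fin m → ℕ) → ℕ
∑∑ f = ∑ λ x → ∑ (f x)

∑∑-+ : ∀ {m} (f g h : Fin m → Fin m → ℕ) → (∀ x y → f x y ≡ g x y + h x y) → ∑∑ f ≡ ∑∑ g + ∑∑ h
∑∑-+ f g h e = ∑-+ _ (λ x → ∑ (g x)) (λ x → ∑ (h x)) λ x → ∑-+ (f x) (g x) (h x) (e x)

∑∑-mono : ∀ {m} (f g : Fin m → Fin m → ℕ) → (∀ x y → f x y ≤ g x y) → ∑∑ f ≤ ∑∑ g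
∑∑-mono f g le = ∑-mono _ _ λ x → ∑-mono (f x) (g x) (le x)

∑∑-term : ∀ {m} (f : Fin m → Fin m → ℕ) x y → f x y ≤ ∑∑ f
∑∑-term f x y = ≤-trans (∑-term (f x) y) (∑-term (λ x → ∑ (f x)) x)

∑∑-zero : ∀ {m} (f : Fin m → Fin m → ℕ) → (∀ x y → f x y ≡ 0) → ∑∑ f ≡ 0
∑∑-zero f z = ∑-zero _ λ x → ∑-zero (f x) (z x)

∑∑-single : ∀ {m} (f : Fin m → Fin m → ℕ) x y → (∀ u v → ¬ (u ≡ x × v ≡ y) → f u v ≡ 0) → ∑∑ f ≡ f x y
∑∑-single f x y z =
  trans (∑-single (λ u → ∑ (f u)) x λ u u≢x → ∑-zero (f u) λ v → z u v (λ uv → u≢x (proj₁ uv)))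
        (∑-single (f x) y λ v v≢y → z x v (λ xv → v≢y (proj₂ xv)))

disagree : Bool → Bool → ℕ
disagree true false = 1
disagree _    _     = 0

disagree-self : ∀ a → disagree a a ≡ 0
disagree-self true  = refl
disagree-self false = refl

disagree-≤1 : ∀ a b → disagree a b ≤ 1
disagree-≤1 true  false = ≤-refl
disagree-≤1 true  true  = z≤n
disagree-≤1 false b     = z≤n

disagree-one : ∀ {a b} → a ≡ true → b ≡ false → 1 ≤ disagree a b
disagree-one refl refl = s≤s z≤n

kendall : ∀ {n} → Rel n → Rel n → ℕ
kendall A B = ∑∑ λ x y → disagree (A x y) (B x y)

module _ {n : ℕ} where

  kendall-≐ : {A B : Rel n} → A ≐ B → kendall A B ≡ 0
  kendall-≐ {A} e = ∑∑-zero _ λ x y → subst (λ b → disagree (A x y) b ≡ 0) (e x y) (disagree-self (A x y))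

  kendall-term : (A B : Rel n) → ∀ x y → disagree (A x y) (B x y) ≤ kendall A B
  kendall-term A B = ∑∑-term λ x y → disagree (A x y) (B x y)

  kendall-triangle : (A B C : Rel n) → kendall A B ≤ kendall A C + kendall C B
  kendall-triangle A B C =
    ≤-trans (∑∑-mono _ _ λ x y → pointwise (A x y) (B x y) (C x y))
            (≤-reflexive (∑∑-+ _ (λ x y → disagree (A x y) (C x y)) (λ x y → disagree (C x y) (B x y)) λ x y → refl))
    where pointwise : ∀ a b c → disagree a b ≤ disagree a c + disagree c b
          pointwise true  false true  = s≤s z≤n
          pointwise true  false false = s≤s z≤n
          pointwise true  true  c     = z≤n
          pointwise false b     c     = z≤n

  -- The Kendall distance is additive along intervals: Q ∈ [A , B] splits
  -- every disagreement of A and B into one of A, Q or of Q, B.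
  kendall-additive : {A B Q : Rel n} → IsStrictLinear A → IsStrictLinear B → IsStrictLinear Q →
    Btw A B Q → kendall A B ≡ kendall A Q + kendall Q B
  kendall-additive {A} {B} {Q} linA linB linQ q = ∑∑-+ _ _ _ pointwise
    where
    pointwise : ∀ x y → disagree (A x y) (B x y) ≡ disagree (A x y) (Q x y) + disagree (Q x y) (B x y)
    pointwise x y with A x y in Axy | B x y in Bxy | Q x y in Qxy
    ... | true  | true  | true  = refl
    ... | true  | true  | false = ⊥-elim (true≢false (trans (sym (q x y Axy Bxy)) Qxy))
    ... | true  | false | true  = refl
    ... | true  | false | false = refl
    ... | false | _     | false = refl
    ... | false | true  | true  = refl
    ... | false | false | true  =
      ⊥-elim (above-both-ways linQ Qxy (q y x (not-above⇒below linA Axy x≢y) (not-above⇒below linB Bxy x≢y)))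
      where x≢y : x ≢ y
            x≢y = above⇒≢ linQ Qxy

  kendall-pos : {A B : Rel n} → IsStrictLinear A → IsStrictLinear B → ¬ A ≐ B → 0 < kendall A B
  kendall-pos {A} {B} linA linB A≉B
    with Fin.¬∀⟶∃¬ n _ (λ x → Fin.all? λ y → A x y ≟ᵇ B x y) A≉B
  ... | x , A≉Bₓ with Fin.¬∀⟶∃¬ n _ (λ y → A x y ≟ᵇ B x y) A≉Bₓ
  ...   | y , Axy≢Bxy with A x y in Axy | B x y in Bxy
  ...     | true  | true  = ⊥-elim (Axy≢Bxy refl)
  ...     | false | false = ⊥-elim (Axy≢Bxy refl)
  ...     | true  | false = ≤-trans (disagree-one Axy Bxy) (kendall-term A B x y)
  ...     | false | true  =
    ≤-trans (disagree-one (not-above⇒below linA Axy (above⇒≢ linB Bxy)) (above-asym linB Bxy)) (kendall-term A B y x)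

Least : (ℕ → Set) → ℕ → Set
Least P k = P k × (∀ k' → P k' → k ≤ k')

search : (P : ℕ → Set) → (∀ k → Dec (P k)) → ∀ b → (∀ k → k < b → ¬ P k) ⊎ ∃[ k ] Least P k
search P P? zero = inj₁ λ k ()
search P P? (suc b) with search P P? b
... | inj₂ found = inj₂ found
... | inj₁ none-below-b with P? b
...   | yes Pb = inj₂ (b , Pb , λ k' Pk' → ≮⇒≥ λ k'<b → none-below-b k' k'<b Pk')
...   | no ¬Pb = inj₁ λ k k<1+b → [ none-below-b k , (λ { refl → ¬Pb }) ] (m≤n⇒m<n∨m≡n (≤-pred k<1+b))

least : (P : ℕ → Set) → (∀ k → Dec (P k)) → ∀ m → P m → ∃[ k ] Least P k
least P P? m Pm = [ (λ none → ⊥-elim (none m ≤-refl Pm)) , (λ found → found) ] (search P P? (suc m))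

module Domain {n : ℕ} (D : List (Rel n)) (linear : All IsStrictLinear D) where

  ∈D-resp : {A B : Rel n} → A ≐ B → A ∈D D → B ∈D D
  ∈D-resp = ∈-resp-≈ ≐-setoid

  member-linear : {A : Rel n} → A ∈D D → IsStrictLinear A
  member-linear = lookupₛ ≐-setoid linear-resp linear

  _∈D? : (A : Rel n) → Dec (A ∈D D)
  A ∈D? = any? (A ≐?_) D

  module _ {A B : Rel n} (adj : Adjacent D A B) where

    adj-∈ˡ : A ∈D D
    adj-∈ˡ = proj₁ adj

    adj-∈ʳ : B ∈D D
    adj-∈ʳ = proj₁ (proj₂ adj)

    adj-≉ : ¬ A ≐ B
    adj-≉ = proj₁ (proj₂ (proj₂ adj))

    adj-minimal : ∀ {Q} → Q ∈D D → Btw A B Q → (Q ≐ A) ⊎ (Q ≐ B)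
    adj-minimal Q∈D q = proj₂ (proj₂ (proj₂ adj)) _ Q∈D (member-linear Q∈D , q)

    linearˡ : IsStrictLinear A
    linearˡ = member-linear adj-∈ˡ

    linearʳ : IsStrictLinear B
    linearʳ = member-linear adj-∈ʳ

  adj-sym : {A B : Rel n} → Adjacent D A B → Adjacent D B A
  adj-sym (A∈D , B∈D , A≉B , minimal) =
    B∈D , A∈D , (λ e → A≉B (≐-sym e)) , λ Q Q∈D (linQ , q) → ⊎-swap (minimal Q Q∈D (linQ , btw-sym q))

  adj-respˡ : {A A' B : Rel n} → A ≐ A' → Adjacent D A B → Adjacent D A' B
  adj-respˡ e (A∈D , B∈D , A≉B , minimal) =
    ∈D-resp e A∈D , B∈D , (λ e' → A≉B (≐-trans e e')) ,
    λ Q Q∈D (linQ , q) → ⊎-map (λ f → ≐-trans f e) (λ f → f)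
                           (minimal Q Q∈D (linQ , btw-resp (≐-sym e) ≐-refl ≐-refl q))

  adj-respʳ : {A B B' : Rel n} → B ≐ B' → Adjacent D A B → Adjacent D A B'
  adj-respʳ e adj = adj-sym (adj-respˡ e (adj-sym adj))

  -- Adjacency is decidable: the minimality clause quantifies over the
  -- finite list D.
  adjacent? : (A B : Rel n) → Dec (Adjacent D A B)
  adjacent? A B = A ∈D? ×-dec B ∈D? ×-dec ¬? (A ≐? B) ×-dec
    map′ fromAll toAll (all? (λ U → btw? A B U →-dec (U ≐? A ⊎-dec U ≐? B)) D)
    where
    Minimal : Rel n → Set
    Minimal U = Btw A B U → (U ≐ A) ⊎ (U ≐ B)
    minimal-resp : {U V : Rel n} → U ≐ V → Minimal U → Minimal V
    minimal-resp e m v = ⊎-map (≐-trans (≐-sym e)) (≐-trans (≐-sym e)) (m (btw-resp ≐-refl ≐-refl (≐-sym e) v))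
    fromAll : All Minimal D → ∀ Q → Q ∈D D → Between A B Q → (Q ≐ A) ⊎ (Q ≐ B)
    fromAll all Q Q∈D (_ , q) = lookupₛ ≐-setoid minimal-resp all Q∈D q
    toAll : (∀ Q → Q ∈D D → Between A B Q → (Q ≐ A) ⊎ (Q ≐ B)) → All Minimal D
    toAll minimal = tabulateₛ ≐-setoid λ U∈D u → minimal _ U∈D (member-linear U∈D , u)

  data Path : Rel n → Rel n → ℕ → Set where
    nil  : ∀ {A B} → A ≐ B → Path A B 0
    cons : ∀ {A C B k} → Adjacent D A C → Path C B k → Path A B (suc k)

  infix 4 _∈ₚ_
  _∈ₚ_ : ∀ {A B k} → Rel n → Path A B k → Set
  Q ∈ₚ nil {A} _    = Q ≐ A
  Q ∈ₚ cons {A} _ p = (Q ≐ A) ⊎ Q ∈ₚ p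

  infix 4 _⊆ₚ_
  _⊆ₚ_ : ∀ {A B k A' B' k'} → Path A B k → Path A' B' k' → Set
  p ⊆ₚ q = ∀ {Q} → Q ∈ₚ p → Q ∈ₚ q

  start-∈ₚ : ∀ {A B k} (p : Path A B k) → A ∈ₚ p
  start-∈ₚ (nil _)    = ≐-refl
  start-∈ₚ (cons _ _) = inj₁ ≐-refl

  ∈ₚ-resp : ∀ {A B k Q Q'} (p : Path A B k) → Q ≐ Q' → Q ∈ₚ p → Q' ∈ₚ p
  ∈ₚ-resp (nil _)    e o        = ≐-trans (≐-sym e) o
  ∈ₚ-resp (cons _ p) e (inj₁ o) = inj₁ (≐-trans (≐-sym e) o)
  ∈ₚ-resp (cons _ p) e (inj₂ o) = inj₂ (∈ₚ-resp p e o)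

  path-resp : ∀ {A A' B k} → A' ≐ A → Path A B k → Path A' B k
  path-resp e (nil f)    = nil (≐-trans e f)
  path-resp e (cons a p) = cons (adj-respˡ (≐-sym e) a) p

  path-resp-⊇ : ∀ {A A' B k} (e : A' ≐ A) (p : Path A B k) → p ⊆ₚ path-resp e p
  path-resp-⊇ e (nil f)    o        = ≐-trans o (≐-sym e)
  path-resp-⊇ e (cons a p) (inj₁ o) = inj₁ (≐-trans o (≐-sym e))
  path-resp-⊇ e (cons a p) (inj₂ o) = inj₂ o

  path-resp-⊆ : ∀ {A A' B k} (e : A' ≐ A) (p : Path A B k) → path-resp e p ⊆ₚ p
  path-resp-⊆ e (nil f)    o        = ≐-trans o e
  path-resp-⊆ e (cons a p) (inj₁ o) = inj₁ (≐-trans o e)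
  path-resp-⊆ e (cons a p) (inj₂ o) = inj₂ o

  infixr 5 _++ₚ_
  _++ₚ_ : ∀ {A B C k l} → Path A B k → Path B C l → Path A C (k + l)
  nil e    ++ₚ q = path-resp e q
  cons a p ++ₚ q = cons a (p ++ₚ q)

  ∈ₚ-++ : ∀ {A B C k l Q} (p : Path A B k) (q : Path B C l) → Q ∈ₚ p ++ₚ q → Q ∈ₚ p ⊎ Q ∈ₚ q
  ∈ₚ-++ (nil e)    q o        = inj₂ (path-resp-⊆ e q o)
  ∈ₚ-++ (cons a p) q (inj₁ o) = inj₁ (inj₁ o)
  ∈ₚ-++ (cons a p) q (inj₂ o) = ⊎-map inj₂ (λ o' → o') (∈ₚ-++ p q o)

  ∈ₚ-++ʳ : ∀ {A B C k l} (p : Path A B k) (q : Path B C l) → q ⊆ₚ p ++ₚ q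
  ∈ₚ-++ʳ (nil e)    q o = path-resp-⊇ e q o
  ∈ₚ-++ʳ (cons a p) q o = inj₂ (∈ₚ-++ʳ p q o)

  snoc : ∀ {A B C k} → Path A B k → Adjacent D B C → Path A C (suc k)
  snoc (nil e)    b = cons (adj-respˡ (≐-sym e) b) (nil ≐-refl)
  snoc (cons a p) b = cons a (snoc p b)

  ∈ₚ-snoc : ∀ {A B C k Q} (p : Path A B k) (b : Adjacent D B C) → Q ∈ₚ snoc p b → Q ∈ₚ p ⊎ Q ≐ C
  ∈ₚ-snoc (nil e)    b (inj₁ o) = inj₁ o
  ∈ₚ-snoc (nil e)    b (inj₂ o) = inj₂ o
  ∈ₚ-snoc (cons a p) b (inj₁ o) = inj₁ (inj₁ o)
  ∈ₚ-snoc (cons a p) b (inj₂ o) = ⊎-map inj₂ (λ o' → o') (∈ₚ-snoc p b o)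

  reverse : ∀ {A B k} → Path A B k → Path B A k
  reverse (nil e)    = nil (≐-sym e)
  reverse (cons a p) = snoc (reverse p) (adj-sym a)

  ∈ₚ-reverse : ∀ {A B k} (p : Path A B k) → reverse p ⊆ₚ p
  ∈ₚ-reverse (nil e)    o = ≐-trans o (≐-sym e)
  ∈ₚ-reverse (cons a p) o with ∈ₚ-snoc (reverse p) (adj-sym a) o
  ... | inj₁ o' = inj₂ (∈ₚ-reverse p o')
  ... | inj₂ o' = inj₁ o'

  path? : ∀ k (A B : Rel n) → Dec (Path A B k)
  path? zero    A B = map′ nil (λ { (nil e) → e }) (A ≐? B)
  path? (suc k) A B = map′ fromAny toAny (any? (λ C → adjacent? A C ×-dec path? k C B) D)
    where
    fromAny : Any (λ C → Adjacent D A C × Path C B k) D → Path A B (suc k)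
    fromAny found with find ≐-setoid found
    ... | C , _ , a , p = cons a p
    toAny : Path A B (suc k) → Any (λ C → Adjacent D A C × Path C B k) D
    toAny (cons a p) = any-map (λ e → adj-respʳ e a , path-resp (≐-sym e) p) (adj-∈ʳ a)

  data Monotone : Rel n → Rel n → ℕ → Set where
    mnil  : ∀ {A B} → A ≐ B → Monotone A B 0
    mcons : ∀ {A C B k} → Adjacent D A C → Btw A B C → Monotone C B k → Monotone A B (suc k)

  monotone-path : ∀ {A B k} → Monotone A B k → Path A B k
  monotone-path (mnil e)      = nil e
  monotone-path (mcons a _ m) = cons a (monotone-path m)

  monotone-btw : ∀ {A B k Q} (m : Monotone A B k) → Q ∈ₚ monotone-path m → Btw A B Q
  monotone-btw (mnil e)      o        = btw-resp ≐-refl ≐-refl (≐-sym o) btw-left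
  monotone-btw (mcons a c m) (inj₁ o) = btw-resp ≐-refl ≐-refl (≐-sym o) btw-left
  monotone-btw (mcons a c m) (inj₂ o) = btw-nestʳ c (monotone-btw m o)

  monotone-resp : ∀ {A A' B k} → A' ≐ A → Monotone A B k → Monotone A' B k
  monotone-resp e (mnil f)      = mnil (≐-trans e f)
  monotone-resp e (mcons a c m) = mcons (adj-respˡ (≐-sym e) a) (btw-resp (≐-sym e) ≐-refl ≐-refl c) m

  monotone-++ : ∀ {A Q B k l} → Q ∈D D → Monotone A Q k → Btw A B Q → Monotone Q B l → Monotone A B (k + l)
  monotone-++ Q∈D (mnil e)      q m₂ = monotone-resp e m₂
  monotone-++ Q∈D (mcons a c m₁) q m₂ =
    mcons a (btw-nestˡ q c) (monotone-++ Q∈D m₁ (btw-exchange (linearˡ a) (member-linear Q∈D) (linearʳ a) q c) m₂)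

  -- Each step of a monotone path lowers the Kendall distance to the
  -- target, so its length is at most the Kendall distance.
  monotone-length : ∀ {A B k} → B ∈D D → Monotone A B k → k ≤ kendall A B
  monotone-length B∈D (mnil e)      = z≤n
  monotone-length {A} {B} B∈D (mcons {C = C} a c m) = begin
    suc _                        ≤⟨ +-mono-≤ (kendall-pos (linearˡ a) (linearʳ a) (adj-≉ a)) (monotone-length B∈D m) ⟩
    kendall A C + kendall C B    ≡⟨ sym (kendall-additive (linearˡ a) (member-linear B∈D) (linearʳ a) c) ⟩
    kendall A B                  ∎
    where open ≤-Reasoning

  adjacent-or-split : ∀ {A B} → A ∈D D → B ∈D D → ¬ A ≐ B →
    Adjacent D A B ⊎ Σ (Rel n) λ T → T ∈D D × Btw A B T × ¬ T ≐ A × ¬ T ≐ B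
  adjacent-or-split {A} {B} A∈D B∈D A≉B with any? (λ T → btw? A B T ×-dec ¬? (T ≐? A) ×-dec ¬? (T ≐? B)) D
  ... | yes found with find ≐-setoid found
  ...   | T , T∈D , t = inj₂ (T , T∈D , t)
  adjacent-or-split {A} {B} A∈D B∈D A≉B | no none = inj₁ (A∈D , B∈D , A≉B , minimal)
    where
    minimal : ∀ Q → Q ∈D D → Between A B Q → (Q ≐ A) ⊎ (Q ≐ B)
    minimal Q Q∈D (_ , q) with Q ≐? A | Q ≐? B
    ... | yes e | _     = inj₁ e
    ... | no _  | yes e = inj₂ e
    ... | no Q≉A | no Q≉B = ⊥-elim (none (any-map (λ e →
            btw-resp ≐-refl ≐-refl e q , (λ f → Q≉A (≐-trans e f)) , (λ f → Q≉B (≐-trans e f))) Q∈D))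

  -- Any two members of D are joined by a monotone path: split at a member
  -- strictly between them until only adjacent pairs remain (induction on
  -- the Kendall distance).
  monotone-exists : ∀ {A B} → A ∈D D → B ∈D D → ∃[ k ] Monotone A B k
  monotone-exists {A} {B} A∈D B∈D = go A∈D B∈D (<-wellFounded (kendall A B))
    where
    go : ∀ {A B} → A ∈D D → B ∈D D → Acc _<_ (kendall A B) → ∃[ k ] Monotone A B k
    go {A} {B} A∈D B∈D (acc smaller) with A ≐? B
    ... | yes e = 0 , mnil e
    ... | no A≉B with adjacent-or-split A∈D B∈D A≉B
    ...   | inj₁ adj = 1 , mcons adj btw-right (mnil ≐-refl)
    ...   | inj₂ (T , T∈D , t , T≉A , T≉B)
      with go A∈D T∈D (smaller closer-to-A) | go T∈D B∈D (smaller closer-to-B)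
      where
      linA : IsStrictLinear A
      linA = member-linear A∈D
      linB : IsStrictLinear B
      linB = member-linear B∈D
      linT : IsStrictLinear T
      linT = member-linear T∈D
      split : kendall A B ≡ kendall A T + kendall T B
      split = kendall-additive linA linB linT t
      closer-to-A : kendall A T < kendall A B
      closer-to-A = <-≤-trans (m<m+n (kendall A T) (kendall-pos linT linB T≉B)) (≤-reflexive (sym split))
      closer-to-B : kendall T B < kendall A B
      closer-to-B = <-≤-trans (m<n+m (kendall T B) (kendall-pos linA linT λ e → T≉A (≐-sym e))) (≤-reflexive (sym split))
    ...     | k₁ , m₁ | k₂ , m₂ = k₁ + k₂ , monotone-++ T∈D m₁ t m₂

  vertex : ∀ {A B k} → Path A B k → Fin (suc k) → Rel n
  vertex (nil {A} _)    zero    = A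
  vertex (cons {A} _ p) zero    = A
  vertex (cons _ p)     (suc i) = vertex p i

  vertex-start : ∀ {A B k} (p : Path A B k) → vertex p zero ≡ A
  vertex-start (nil _)    = refl
  vertex-start (cons _ _) = refl

  vertex-end : ∀ {A B k} (p : Path A B k) → vertex p (fromℕ k) ≐ B
  vertex-end (nil e)    = e
  vertex-end (cons _ p) = vertex-end p

  vertex-∈ₚ : ∀ {A B k Q} (p : Path A B k) i → Q ≐ vertex p i → Q ∈ₚ p
  vertex-∈ₚ (nil _)    zero    e = e
  vertex-∈ₚ (cons _ p) zero    e = inj₁ e
  vertex-∈ₚ (cons _ p) (suc i) e = inj₂ (vertex-∈ₚ p i e)

  ∈ₚ-vertex : ∀ {A B k Q} (p : Path A B k) → Q ∈ₚ p → ∃[ i ] Q ≐ vertex p i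
  ∈ₚ-vertex (nil _)    o        = zero , o
  ∈ₚ-vertex (cons _ p) (inj₁ o) = zero , o
  ∈ₚ-vertex (cons _ p) (inj₂ o) with ∈ₚ-vertex p o
  ... | i , e = suc i , e

  vertex-walk : ∀ {A B k} (p : Path A B k) → IsWalk D k (vertex p)
  vertex-walk (cons {C = C} a p) zero    = adj-respʳ (subst (C ≐_) (sym (vertex-start p)) ≐-refl) a
  vertex-walk (cons a p)         (suc i) = vertex-walk p i

  path→walk : ∀ {A B k} → Path A B k → Walk D A B k
  path→walk p = vertex p , vertex-walk p , subst (_≐ _) (sym (vertex-start p)) ≐-refl , vertex-end p

  walk→path : ∀ {A B k} (w : Walk D A B k) → Σ (Path A B k) λ p → ∀ {Q} i → Q ≐ proj₁ w i → Q ∈ₚ p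
  walk→path {k = k} (v , walk , start , end) =
    path-resp (≐-sym start) (go k v walk end) ,
    λ i e → path-resp-⊇ (≐-sym start) (go k v walk end) (vertex-∈ₚ _ i (subst (_ ≐_) (sym (go-vertex k v walk end i)) e))
    where
    go : ∀ k (v : Fin (suc k) → Rel n) → IsWalk D k v → ∀ {B} → v (fromℕ k) ≐ B → Path (v zero) B k
    go zero    v walk end = nil end
    go (suc k) v walk end = cons (walk zero) (go k (λ i → v (suc i)) (λ i → walk (suc i)) end)
    go-vertex : ∀ k (v : Fin (suc k) → Rel n) (walk : IsWalk D k v) {B} (end : v (fromℕ k) ≐ B) i →
      vertex (go k v walk end) i ≡ v i
    go-vertex zero    v walk end zero    = refl
    go-vertex (suc k) v walk end zero    = refl
    go-vertex (suc k) v walk end (suc i) = go-vertex k (λ i → v (suc i)) (λ i → walk (suc i)) end i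

  Dichotomy : Set
  Dichotomy = ∀ {R S R'} → Adjacent D R S → R' ∈D D → Btw R R' S ⊎ Btw S R' R

  Shortcut : Set
  Shortcut = ∀ {k R S R'} → R' ∈D D → Path R R' k → Adjacent D R S → Btw R R' S →
    ∃[ m ] Path S R' m × m < k

  Shortest : Rel n → Rel n → ℕ → Set
  Shortest A B k = ∀ k' → Path A B k' → k ≤ k'

  module Characterisation (dichotomy : Dichotomy) (shortcut : Shortcut) where

    -- Every vertex of a shortest path from R to R' lies in [R , R']: by the
    -- dichotomy the second vertex C satisfies C ∈ [R , R'] (and we recurse)
    -- or R ∈ [C , R'], in which case the shortcut beats the shortest path.
    shortest⇒between : ∀ {R R' k Q} (p : Path R R' k) → Shortest R R' k → R' ∈D D → Q ∈ₚ p → Btw R R' Q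
    shortest⇒between (nil e)    _ _ o        = btw-resp ≐-refl ≐-refl (≐-sym o) btw-left
    shortest⇒between (cons a p) _ _ (inj₁ o) = btw-resp ≐-refl ≐-refl (≐-sym o) btw-left
    shortest⇒between (cons a p) shortest R'∈D (inj₂ o) with dichotomy a R'∈D
    ... | inj₁ c = btw-nestʳ c (shortest⇒between p (λ k' q → ≤-pred (shortest (suc k') (cons a q))) R'∈D o)
    ... | inj₂ r with shortcut R'∈D p (adj-sym a) r
    ...   | m , q , m<k = ⊥-elim (<-irrefl refl (<-≤-trans m<k (≤-trans (n≤1+n _) (shortest m q))))

    along-monotone : ∀ {C Q R' m k} → Monotone C Q m → Q ∈D D → R' ∈D D → Btw C R' Q → Path C R' k →
      ∃[ j ] Path Q R' j × j + m ≤ k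
    along-monotone {k = k} (mnil e) _ _ _ p = k , path-resp (≐-sym e) p , ≤-reflexive (+-identityʳ k)
    along-monotone {k = k} (mcons a c m) Q∈D R'∈D q p with shortcut R'∈D p a (btw-nestˡ q c)
    ... | k' , p' , k'<k
      with along-monotone m Q∈D R'∈D (btw-exchange (linearˡ a) (member-linear Q∈D) (linearʳ a) q c) p'
    ...   | j , p'' , j+m≤k' = j , p'' , subst (_≤ k) (sym (+-suc j _)) (≤-trans (s≤s j+m≤k') k'<k)

    -- Conversely, Q ∈ [R , R'] lies on the shortest path obtained by going
    -- monotonically from R to Q and then on to R' along the shortened path.
    between⇒shortest : ∀ {R R' Q} → R ∈D D → R' ∈D D → Q ∈D D → Btw R R' Q → OnShortestPath D R R' Q
    between⇒shortest {R} {R'} R∈D R'∈D Q∈D q with monotone-exists R∈D R'∈D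
    ... | k₀ , m₀ with least (λ k → Path R R' k) (λ k → path? k R R') k₀ (monotone-path m₀)
    ... | k , p , shortest with monotone-exists R∈D Q∈D
    ... | m , toQ with along-monotone toQ Q∈D R'∈D q p
    ... | j , fromQ , j+m≤k =
      m + j , path→walk route ,
      (λ k' w → ≤-trans (subst (_≤ k) (+-comm j m) j+m≤k) (shortest k' (proj₁ (walk→path w)))) ,
      ∈ₚ-vertex route (∈ₚ-++ʳ (monotone-path toQ) fromQ (start-∈ₚ fromQ))
      where route : Path R R' (m + j)
            route = monotone-path toQ ++ₚ fromQ

    characterisation : ∀ {R R' Q} → R ∈D D → R' ∈D D → Q ∈D D → Between R R' Q ⇔ OnShortestPath D R R' Q
    characterisation R∈D R'∈D Q∈D = mk⇔
      (λ (_ , q) → between⇒shortest R∈D R'∈D Q∈D q)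
      (λ (_ , w , shortest , i , e) → member-linear Q∈D ,
         shortest⇒between (proj₁ (walk→path w)) (λ k' p → shortest k' (path→walk p)) R'∈D (proj₂ (walk→path w) i e))

  Square : Set
  Square = ∀ {R S P R'} → Adjacent D R S → Adjacent D R P → ¬ S ≐ P → Btw R R' S → Btw R R' P → R' ∈D D →
    Σ (Rel n) λ M → Adjacent D S M × Adjacent D P M × Btw P R' M

  square⇒shortcut : Dichotomy → Square → Shortcut
  square⇒shortcut dichotomy square {k} = go k (<-wellFounded k)
    where
    go : ∀ k → Acc _<_ k → ∀ {R S R'} → R' ∈D D → Path R R' k → Adjacent D R S → Btw R R' S →
      ∃[ m ] Path S R' m × m < k
    -- Length 0: R ≐ R', and S ∈ [R , R] would force S ≐ R.
    go _ _ R'∈D (nil e) a s = ⊥-elim (adj-≉ a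
      (btw-antisym (linearˡ a) (linearˡ a) (linearʳ a) (btw-resp ≐-refl (≐-sym e) ≐-refl s) btw-right))
    go (suc k) (acc smaller) {S = S} R'∈D (cons {C = P} b p) a s with S ≐? P
    ... | yes e = k , path-resp e p , ≤-refl
    -- P₁ ∈ [R , R']: cross the square R , S , P₁ , M and shortcut from P₁ to M.
    ... | no S≉P with dichotomy b R'∈D
    ...   | inj₁ c with square a b S≉P s c R'∈D
    ...     | M , aSM , aPM , m with go k (smaller ≤-refl) R'∈D p aPM m
    ...       | j , q , j<k = suc j , cons aSM q , s≤s j<k
    -- R ∈ [P₁ , R']: shortcut from P₁ back to R, then from R to S.
    go (suc k) (acc smaller) {S = S} R'∈D (cons b p) a s | no S≉P | inj₂ r with go k (smaller ≤-refl) R'∈D p (adj-sym b) r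
    ... | j₁ , q₁ , j₁<k with go j₁ (smaller (m<n⇒m<1+n j₁<k)) R'∈D q₁ a s
    ...   | j₂ , q₂ , j₂<j₁ = j₂ , q₂ , <-trans j₂<j₁ (m<n⇒m<1+n j₁<k)

  module MedianDomain (median : Median D) where

    -- The median of R, S, R' lies in [R , S], so it is R or S.
    dichotomy : Dichotomy
    dichotomy {R} {S} {R'} a R'∈D with median R S R' (adj-∈ˡ a) (adj-∈ʳ a) R'∈D
    ... | M , M∈D , (_ , mRS) , (_ , mRR') , (_ , mSR') with adj-minimal a M∈D mRS
    ...   | inj₁ M≐R = inj₂ (btw-resp ≐-refl ≐-refl M≐R mSR')
    ...   | inj₂ M≐S = inj₁ (btw-resp ≐-refl ≐-refl M≐S mRR')

    median-adjacent : ∀ {R S P R' M} → Adjacent D R S → Adjacent D R P → ¬ S ≐ P →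
      Btw R R' S → Btw R R' P → R' ∈D D → M ∈D D → Btw S P M → Btw S R' M → Btw P R' M → Adjacent D S M
    median-adjacent {R} {S} {P} {R'} {M} aS aP S≉P s p R'∈D M∈D mSP mSR' mPR' = adj-∈ʳ aS , M∈D , S≉M , minimal
      where
      linR : IsStrictLinear R
      linR = linearˡ aS
      linS : IsStrictLinear S
      linS = linearʳ aS
      linP : IsStrictLinear P
      linP = linearʳ aP
      linR' : IsStrictLinear R'
      linR' = member-linear R'∈D
      linM : IsStrictLinear M
      linM = member-linear M∈D

      sRM : Btw R M S
      sRM = btw-geodesic linS linM linR' s mSR'

      -- S ≐ M would put P in [R , S], making P equal to R or to S.
      S≉M : ¬ S ≐ M
      S≉M e with adj-minimal aS (adj-∈ʳ aP) (btw-geodesic linP linS linR' p (btw-resp ≐-refl ≐-refl (≐-sym e) mPR'))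
      ... | inj₁ P≐R = adj-≉ aP (≐-sym P≐R)
      ... | inj₂ P≐S = S≉P (≐-sym P≐S)

      -- For Z ∈ [S , M], the median W of R, Z, P lies in [R , P], so W is R or P.
      minimal : ∀ Z → Z ∈D D → Between S M Z → (Z ≐ S) ⊎ (Z ≐ M)
      minimal Z Z∈D (linZ , z) with median R Z P (adj-∈ˡ aS) Z∈D (adj-∈ʳ aP)
      ... | W , W∈D , (_ , wRZ) , (_ , wRP) , (_ , wZP) with adj-minimal aP W∈D wRP
      -- R ∈ [Z , P] gives Z ∈ [R , S], hence Z ≐ S, as Z ≐ R would give R ∈ [S , M].
      ...   | inj₁ W≐R with adj-minimal aS Z∈D zRS
        where
        rZP : Btw Z P R
        rZP = btw-resp ≐-refl ≐-refl W≐R wZP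
        zRS : Btw R S Z
        zRS = btw-exchange linP linZ linR (btw-sym (btw-nestˡ mSP z)) (btw-sym rZP)
      ...     | inj₁ Z≐R = ⊥-elim (adj-≉ aS (btw-antisym linR linM linS sRM (btw-resp ≐-refl ≐-refl Z≐R z)))
      ...     | inj₂ Z≐S = inj₁ Z≐S
      -- P ∈ [R , Z] gives M ∈ [R , Z] by convexity, while Z ∈ [R , M]; hence Z ≐ M.
      minimal Z Z∈D (linZ , z) | W , W∈D , (_ , wRZ) , (_ , wRP) , (_ , wZP) | inj₂ W≐P =
        inj₂ (≐-sym (btw-antisym linM linR linZ (btw-sym zRM) (btw-sym mRZ)))
        where
        pRZ : Btw R Z P
        pRZ = btw-resp ≐-refl ≐-refl W≐P wRZ
        sRZ : Btw R Z S
        sRZ = btw-geodesic linS linZ linM sRM z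
        mRZ : Btw R Z M
        mRZ = btw-convex sRZ pRZ mSP
        zRM : Btw R M Z
        zRM = btw-nestʳ sRM z

    square : Square
    square aS aP S≉P s p R'∈D with median _ _ _ (adj-∈ʳ aS) (adj-∈ʳ aP) R'∈D
    ... | M , M∈D , (_ , mSP) , (_ , mSR') , (_ , mPR') =
      M , median-adjacent aS aP S≉P s p R'∈D M∈D mSP mSR' mPR' ,
      median-adjacent aP aS (λ e → S≉P (≐-sym e)) p s R'∈D M∈D (btw-sym mSP) mPR' mSR' , mPR'

  module ConnectedDomain (connected : Connected D) where

    swap-between : ∀ {R S T : Rel n} {x y} → IsStrictLinear T → S y x ≡ true → T y x ≡ true →
      (∀ u v → ¬ (u ≡ x × v ≡ y) → ¬ (u ≡ y × v ≡ x) → R u v ≡ S u v) → Btw R T S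
    swap-between {x = x} {y} linT Syx Tyx agree u v Ruv Tuv with u ≟ᶠ x ×-dec v ≟ᶠ y | u ≟ᶠ y ×-dec v ≟ᶠ x
    ... | yes (refl , refl) | _                  = ⊥-elim (above-both-ways linT Tuv Tyx)
    ... | no _              | yes (refl , refl)  = Syx
    ... | no ≢xy            | no ≢yx             = trans (sym (agree u v ≢xy ≢yx)) Ruv

    -- The swapped pair is ranked by R' one way or the other.
    dichotomy : Dichotomy
    dichotomy {R} {S} {R'} a R'∈D with connected R S a
    ... | x , y , Rxy , Syx , agree , _ with R' x y in R'xy
    ...   | true  = inj₂ (swap-between (member-linear R'∈D) Rxy R'xy λ u v ≢yx ≢xy → sym (agree u v ≢xy ≢yx))
    ...   | false = inj₁ (swap-between linR' Syx (not-above⇒below linR' R'xy (above⇒≢ (linearˡ a) Rxy)) agree)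
      where linR' : IsStrictLinear R'
            linR' = member-linear R'∈D

    adjacent-kendall : ∀ {A C} → Adjacent D A C → kendall A C ≤ 1
    adjacent-kendall {A} {C} a with connected A C a
    ... | x , y , Axy , Cyx , agree , _ =
      ≤-trans (≤-reflexive (∑∑-single _ x y vanish)) (disagree-≤1 (A x y) (C x y))
      where
      vanish : ∀ u v → ¬ (u ≡ x × v ≡ y) → disagree (A u v) (C u v) ≡ 0
      vanish u v ≢xy with u ≟ᶠ y ×-dec v ≟ᶠ x
      ... | yes (refl , refl) rewrite above-asym (linearˡ a) Axy = refl
      ... | no ≢yx rewrite agree u v ≢xy ≢yx = disagree-self (C u v)

    kendall-≤-length : ∀ {A B k} → Path A B k → kendall A B ≤ k
    kendall-≤-length (nil e) = ≤-reflexive (kendall-≐ e)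
    kendall-≤-length {A} {B} (cons {C = C} a p) =
      ≤-trans (kendall-triangle A B C) (+-mono-≤ (adjacent-kendall a) (kendall-≤-length p))

    -- A monotone path from S to R' is shorter than the Kendall distance
    -- from R to R', which bounds every path from R to R'.
    shortcut : Shortcut
    shortcut {k} {R} {S} {R'} R'∈D p a s with monotone-exists (adj-∈ʳ a) R'∈D
    ... | m , toR' = m , monotone-path toR' , (begin-strict
      m                           ≤⟨ monotone-length R'∈D toR' ⟩
      kendall S R'                <⟨ m<n+m _ (kendall-pos (linearˡ a) (linearʳ a) (adj-≉ a)) ⟩
      kendall R S + kendall S R'  ≡⟨ sym (kendall-additive (linearˡ a) (member-linear R'∈D) (linearʳ a) s) ⟩
      kendall R R'                ≤⟨ kendall-≤-length p ⟩
      k                           ∎)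
      where open ≤-Reasoning

  module AcyclicDomain (acyclic : Acyclic D) where

    _∈ₚ?_ : ∀ {A B k} (Q : Rel n) (p : Path A B k) → Dec (Q ∈ₚ p)
    Q ∈ₚ? nil {A} _    = Q ≐? A
    Q ∈ₚ? cons {A} _ p = Q ≐? A ⊎-dec Q ∈ₚ? p

    Simple : ∀ {A B k} → Path A B k → Set
    Simple (nil _)        = ⊤
    Simple (cons {A} _ p) = ¬ A ∈ₚ p × Simple p

    suffix : ∀ {A C B k} (p : Path C B k) → Simple p → A ∈ₚ p →
      ∃[ k' ] Σ (Path A B k') λ q → Simple q × q ⊆ₚ p
    suffix (nil e) _ o = 0 , nil (≐-trans o e) , tt , λ o' → ≐-trans o' o
    suffix (cons b p) (C∉p , simple) (inj₁ o) =
      _ , path-resp o (cons b p) , ((λ o' → C∉p (∈ₚ-resp p o o')) , simple) , path-resp-⊆ o (cons b p)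
    suffix (cons b p) (_ , simple) (inj₂ o) with suffix p simple o
    ... | k' , q , simple-q , q⊆p = k' , q , simple-q , λ o' → inj₂ (q⊆p o')

    loop-erase : ∀ {A B k} (p : Path A B k) → ∃[ k' ] Σ (Path A B k') λ q → Simple q × q ⊆ₚ p
    loop-erase (nil e) = 0 , nil e , tt , λ o → o
    loop-erase (cons {A} a p) with loop-erase p
    ... | k₁ , q , simple , q⊆p with A ∈ₚ? q
    ...   | no A∉q = suc k₁ , cons a q , (A∉q , simple) , λ { (inj₁ o) → inj₁ o ; (inj₂ o) → inj₂ (q⊆p o) }
    ...   | yes A∈q with suffix q simple A∈q
    ...     | k' , r , simple-r , r⊆q = k' , r , simple-r , λ o → inj₂ (q⊆p (r⊆q o))

    simple-injective : ∀ {A B k} (p : Path A B k) → Simple p → ∀ i j → vertex p i ≐ vertex p j → i ≡ j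
    simple-injective (nil _)    _         zero    zero    _ = refl
    simple-injective (cons _ p) _         zero    zero    _ = refl
    simple-injective (cons _ p) (A∉p , _) zero    (suc j) e = ⊥-elim (A∉p (vertex-∈ₚ p j e))
    simple-injective (cons _ p) (A∉p , _) (suc i) zero    e = ⊥-elim (A∉p (vertex-∈ₚ p i (≐-sym e)))
    simple-injective (cons _ p) (_ , sp)  (suc i) (suc j) e = cong suc (simple-injective p sp i j e)

    vertex-snoc : ∀ {A B C k} (p : Path A B k) (b : Adjacent D B C) i → vertex (snoc p b) (inject₁ i) ≡ vertex p i
    vertex-snoc (nil _)    b zero    = refl
    vertex-snoc (cons _ p) b zero    = refl
    vertex-snoc (cons _ p) b (suc i) = vertex-snoc p b i

    -- Every path between distinct neighbours A, B of R passes through R: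
    -- otherwise R , A , … , B , R, after loop erasure, would be a cycle.
    through-hub : ∀ {R A B k} → Adjacent D R A → Adjacent D R B → ¬ A ≐ B → (p : Path A B k) → R ∈ₚ p
    through-hub {R} aA aB A≉B p with R ∈ₚ? p
    ... | yes R∈p = R∈p
    ... | no R∉p with loop-erase p
    ...   | _ , nil e , _ = ⊥-elim (A≉B e)
    ...   | suc k , q , simple , q⊆p =
      ⊥-elim (acyclic (3 + k , vertex cycle , s≤s (s≤s (s≤s z≤n)) , vertex-walk cycle , ≐-sym (vertex-end cycle) , distinct))
      where
      cycle : Path R R (3 + k)
      cycle = cons aA (snoc q (adj-sym aB))
      R∉q : ∀ j → ¬ R ≐ vertex (snoc q (adj-sym aB)) (inject₁ j)
      R∉q j e = R∉p (q⊆p (vertex-∈ₚ q j (subst (R ≐_) (vertex-snoc q (adj-sym aB) j) e)))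
      distinct : ∀ i j → vertex cycle (inject₁ i) ≐ vertex cycle (inject₁ j) → i ≡ j
      distinct zero    zero    _ = refl
      distinct zero    (suc j) e = ⊥-elim (R∉q j e)
      distinct (suc i) zero    e = ⊥-elim (R∉q i (≐-sym e))
      distinct (suc i) (suc j) e =
        cong suc (simple-injective q simple i j (subst₂ _≐_ (vertex-snoc q (adj-sym aB) i) (vertex-snoc q (adj-sym aB) j) e))

    hub-on-monotone : ∀ {R A B R' k l} → Adjacent D R A → Adjacent D R B → ¬ A ≐ B →
      (mA : Monotone A R' k) (mB : Monotone B R' l) → R ∈ₚ monotone-path mA ⊎ R ∈ₚ monotone-path mB
    hub-on-monotone aA aB A≉B mA mB =
      ⊎-map (λ o → o) (∈ₚ-reverse (monotone-path mB))
        (∈ₚ-++ _ _ (through-hub aA aB A≉B (monotone-path mA ++ₚ reverse (monotone-path mB))))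

    monotone-avoids : ∀ {R A R' k} → Adjacent D R A → R' ∈D D → Btw R R' A → (m : Monotone A R' k) →
      ¬ R ∈ₚ monotone-path m
    monotone-avoids a R'∈D r m o = adj-≉ a (btw-antisym (linearˡ a) (member-linear R'∈D) (linearʳ a) r (monotone-btw m o))

    -- If neither S ∈ [R , R'] nor R ∈ [S , R'], then R ≉ R' and the first
    -- step C of a monotone path from R to R' is a neighbour of R other than
    -- S; the monotone paths from C and from S to R' both avoid R.
    dichotomy : Dichotomy
    dichotomy {R} {S} {R'} a R'∈D with btw? R R' S | btw? S R' R
    ... | yes s | _     = inj₁ s
    ... | no _  | yes r = inj₂ r
    ... | no ¬s | no ¬r with monotone-exists (adj-∈ˡ a) R'∈D | monotone-exists (adj-∈ʳ a) R'∈D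
    ...   | _ , mnil R≐R' | _ = ⊥-elim (¬r (btw-resp ≐-refl ≐-refl (≐-sym R≐R') btw-right))
    ...   | _ , mcons c cC fromC | _ , fromS =
      ⊥-elim ([ monotone-avoids c R'∈D cC fromC , (λ o → ¬r (monotone-btw fromS o)) ]
                (hub-on-monotone c a (λ e → ¬s (btw-resp ≐-refl ≐-refl e cC)) fromC fromS))

    -- The square property holds vacuously: distinct neighbours S, P of R
    -- never both lie in [R , R'].
    square : Square
    square aS aP S≉P s p R'∈D with monotone-exists (adj-∈ʳ aS) R'∈D | monotone-exists (adj-∈ʳ aP) R'∈D
    ... | _ , fromS | _ , fromP =
      ⊥-elim ([ monotone-avoids aS R'∈D s fromS , monotone-avoids aP R'∈D p fromP ]
                (hub-on-monotone aS aP S≉P fromS fromP))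

  dichotomy-and-shortcut : Median D ⊎ Connected D ⊎ Acyclic D → Dichotomy × Shortcut
  dichotomy-and-shortcut (inj₁ median) = M.dichotomy , square⇒shortcut M.dichotomy M.square
    where module M = MedianDomain median
  dichotomy-and-shortcut (inj₂ (inj₁ connected)) = C.dichotomy , C.shortcut
    where module C = ConnectedDomain connected
  dichotomy-and-shortcut (inj₂ (inj₂ acyclic)) = T.dichotomy , square⇒shortcut T.dichotomy T.square
    where module T = AcyclicDomain acyclic

lemma3p1 : (n : ℕ) (D : List (Rel n)) → All IsStrictLinear D →
    (Median D ⊎ Connected D ⊎ Acyclic D) →
    ∀ R R' Q → R ∈D D → R' ∈D D → Q ∈D D →
    (Between R R' Q ⇔ OnShortestPath D R R' Q)
lemma3p1 n D linear hypothesis R R' Q R∈D R'∈D Q∈D = characterisation R∈D R'∈D Q∈D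
  where
  open Domain D linear
  open Characterisation (proj₁ (dichotomy-and-shortcut hypothesis)) (proj₂ (dichotomy-and-shortcut hypothesis))
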